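{- $\mathcal{EL}^+$ with role inclusions of the form $r_1 \circ r_2 \sqsubseteq s$ does not have the $\sqsubseteq$-interpolation property w.r.t. intersection-sharing: there exist CBoxes $\mathcal{C}_A = GCI_A \cup \mathcal{R}_A$, $\mathcal{C}_B = GCI_B \cup \mathcal{R}_B$ (with role inclusions of the form $r_1 \circ r_2 \sqsubseteq s$) and concept descriptions $C, D$ with $\mathcal{C}_A \cup \mathcal{C}_B \models C \sqsubseteq D$ such that there is no concept description $T$ containing only concept names and role names that occur both in $\{\mathcal{C}_A, C\}$ and in $\{\mathcal{C}_B, D\}$ with $\mathcal{C}_A \cup \mathcal{C}_B \models C \sqsubseteq T$ and $\mathcal{C}_A \cup \mathcal{C}_B \models T \sqsubseteq D$.
   Context: $\mathcal{EL}^+$ concept descriptions are built from concept names using conjunction $C_1 \sqcap C_2$ and existential restriction $\exists r.C$ for role names $r$. An interpretation $\mathcal{I} = (\Delta, \cdot^{\mathcal{I}})$ assigns subsets of $\Delta$ to concept names and binary relations on $\Delta$ to role names, with $(C_1 \sqcap C_2)^{\mathcal{I}} = C_1^{\mathcal{I}} \cap C_2^{\mathcal{I}}$ and $(\exists r.C)^{\mathcal{I}} = \{x \mid \exists y ((x,y) \in r^{\mathcal{I}}, y \in C^{\mathcal{I}})\}$. A CBox is a union of a finite set of general concept inclusions $C \sqsubseteq D$ and a finite set of role inclusions; $\mathcal{I}$ is a model of it if $C^{\mathcal{I}} \subseteq D^{\mathcal{I}}$ for each GCI and $r_1^{\mathcal{I}} \circ r_2^{\mathcal{I}} \subseteq s^{\mathcal{I}}$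 for each role inclusion $r_1 \circ r_2 \sqsubseteq s$. $\mathcal{C} \models C \sqsubseteq D$ iff $C^{\mathcal{I}} \subseteq D^{\mathcal{I}}$ in every model of $\mathcal{C}$. -}

module Defs where

open import Data.Nat using (ℕ)
open import Data.List using (List; _++_)
open import Data.List.Relation.Unary.All using (All)
open import Data.List.Relation.Unary.Any using (Any)
open import Data.Product using (_×_; Σ)
open import Data.Sum using (_⊎_)
open import Data.Empty using (⊥)
open import Relation.Binary.PropositionalEquality using (_≡_)

ConceptName : Set
ConceptName = ℕ

RoleName : Set
RoleName = ℕ

data Concept : Set where
  cname : ConceptName → Concept
  _⊓_   : Concept → Concept → Concept
  ex    : RoleName → Concept → Concept

record GCI : Set where
  constructor _⊑_
  field
    lhs : Concept
    rhs : Concept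

record RI : Set where
  constructor _∘_⊑ᵣ_
  field
    r₁ : RoleName
    r₂ : RoleName
    s  : RoleName

record CBox : Set where
  constructor cbox
  field
    gcis : List GCI
    ris  : List RI

_∪_ : CBox → CBox → CBox
cbox g₁ r₁ ∪ cbox g₂ r₂ = cbox (g₁ ++ g₂) (r₁ ++ r₂)

record Interp : Set₁ where
  field
    Δ    : Set
    conc : ConceptName → Δ → Set
    role : RoleName → Δ → Δ → Set

open Interp public

⟦_⟧ : Concept → (I : Interp) → Δ I → Set
⟦ cname A ⟧ I x = conc I A x
⟦ C ⊓ D ⟧   I x = ⟦ C ⟧ I x × ⟦ D ⟧ I x
⟦ ex r C ⟧  I x = Σ (Δ I) λ y → role I r x y × ⟦ C ⟧ I y

SatGCI : Interp → GCI → Set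
SatGCI I (C ⊑ D) = ∀ x → ⟦ C ⟧ I x → ⟦ D ⟧ I x

SatRI : Interp → RI → Set
SatRI I (r ∘ r' ⊑ᵣ s) = ∀ x y z → role I r x y → role I r' y z → role I s x z

Model : Interp → CBox → Set
Model I (cbox g r) = All (SatGCI I) g × All (SatRI I) r

_⊨_⊑_ : CBox → Concept → Concept → Set₁
𝒞 ⊨ C ⊑ D = (I : Interp) → Model I 𝒞 → ∀ x → ⟦ C ⟧ I x → ⟦ D ⟧ I x

CNin : ConceptName → Concept → Set
CNin A (cname B) = A ≡ B
CNin A (C ⊓ D)   = CNin A C ⊎ CNin A D
CNin A (ex r C)  = CNin A C

RNin : RoleName → Concept → Set
RNin r (cname B) = ⊥
RNin r (C ⊓ D)   = RNin r C ⊎ RNin r D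
RNin r (ex s C)  = r ≡ s ⊎ RNin r C

CNinGCI : ConceptName → GCI → Set
CNinGCI A (C ⊑ D) = CNin A C ⊎ CNin A D

RNinGCI : RoleName → GCI → Set
RNinGCI r (C ⊑ D) = RNin r C ⊎ RNin r D

RNinRI : RoleName → RI → Set
RNinRI r (r₁ ∘ r₂ ⊑ᵣ s) = r ≡ r₁ ⊎ r ≡ r₂ ⊎ r ≡ s

CNinSig : ConceptName → CBox → Concept → Set
CNinSig A (cbox g rs) C = Any (CNinGCI A) g ⊎ CNin A C

RNinSig : RoleName → CBox → Concept → Set
RNinSig r (cbox g rs) C = Any (RNinGCI r) g ⊎ Any (RNinRI r) rs ⊎ RNin r C

SharedOnly : Concept → CBox → Concept → CBox → Concept → Set
SharedOnly T 𝒞A C 𝒞B D =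
  (∀ A → CNin A T → CNinSig A 𝒞A C × CNinSig A 𝒞B D) ×
  (∀ r → RNin r T → RNinSig r 𝒞A C × RNinSig r 𝒞B D)

-- Take 𝒞A = {A₀ ⊑ ∃r₀.A₁, r₀ ∘ r₁ ⊑ r₂} and 𝒞B = {A₁ ⊑ ∃r₁.A₂, ∃r₂.A₂ ⊑ A₃}.
-- Together they entail A₀ ⊑ A₃, but the shared signature is only {A₁; r₁, r₂}.
-- In the model x -r₀→ y -r₁→ z, x -r₂→ z with x ∈ A₀ ∩ A₃, y ∈ A₁, z ∈ A₂, no
-- concept over the shared signature holds at x: x ∉ A₁, and the only successor
-- of x along a shared role is z, which is not in A₁ and has no successors.
-- So no interpolant can follow from A₀.
module Submission where

open import Defs
open import Data.Product using (Σ; _×_; _,_)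
open import Data.Sum using (inj₁; inj₂)
open import Data.Empty using (⊥-elim)
open import Function using (_∘_)
open import Data.List using ([]; _∷_)
open import Data.List.Relation.Unary.All using ([]; _∷_)
open import Data.List.Relation.Unary.Any using (here; there)
open import Relation.Nullary using (¬_)
open import Relation.Binary.PropositionalEquality using (_≡_; _≢_; refl)

ConceptNamesWithin : (ConceptName → Set) → Concept → Set
ConceptNamesWithin P T = ∀ A → CNin A T → P A

RoleNamesWithin : (RoleName → Set) → Concept → Set
RoleNamesWithin P T = ∀ r → RNin r T → P r

no-interpolant-if-refuted-in-model :
  ∀ {𝒞A 𝒞B C D} (I : Interp) → Model I (𝒞A ∪ 𝒞B) → ∀ x → ⟦ C ⟧ I x →
  (∀ T → SharedOnly T 𝒞A C 𝒞B D → ¬ ⟦ T ⟧ I x) →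
  ¬ (Σ Concept λ T → SharedOnly T 𝒞A C 𝒞B D × ((𝒞A ∪ 𝒞B) ⊨ C ⊑ T) × ((𝒞A ∪ 𝒞B) ⊨ T ⊑ D))
no-interpolant-if-refuted-in-model I model x Cx refuted (T , shared , C⊑T , _) =
  refuted T shared (C⊑T I model x Cx)

𝒞A : CBox
𝒞A = cbox ((cname 0 ⊑ ex 0 (cname 1)) ∷ []) ((0 ∘ 1 ⊑ᵣ 2) ∷ [])

𝒞B : CBox
𝒞B = cbox ((cname 1 ⊑ ex 1 (cname 2)) ∷ (ex 2 (cname 2) ⊑ cname 3) ∷ []) []

𝒞A∪𝒞B⊨A₀⊑A₃ : (𝒞A ∪ 𝒞B) ⊨ cname 0 ⊑ cname 3
𝒞A∪𝒞B⊨A₀⊑A₃ I ((A₀⊑∃r₀A₁ ∷ A₁⊑∃r₁A₂ ∷ ∃r₂A₂⊑A₃ ∷ []) , (r₀∘r₁⊑r₂ ∷ [])) x A₀x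
  with A₀⊑∃r₀A₁ x A₀x
... | y , r₀xy , A₁y with A₁⊑∃r₁A₂ y A₁y
... | z , r₁yz , A₂z = ∃r₂A₂⊑A₃ x (z , r₀∘r₁⊑r₂ x y z r₀xy r₁yz , A₂z)

A₀∉𝒞B : ¬ CNinSig 0 𝒞B (cname 3)
A₀∉𝒞B (inj₁ (here (inj₁ ())))
A₀∉𝒞B (inj₁ (here (inj₂ ())))
A₀∉𝒞B (inj₁ (there (here (inj₁ ()))))
A₀∉𝒞B (inj₁ (there (here (inj₂ ()))))
A₀∉𝒞B (inj₂ ())

shared-concept-name : ∀ A → CNinSig A 𝒞A (cname 0) → CNinSig A 𝒞B (cname 3) → A ≡ 1
shared-concept-name A (inj₁ (here (inj₂ refl))) _  = refl
shared-concept-name A (inj₁ (here (inj₁ refl))) inB = ⊥-elim (A₀∉𝒞B inB)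
shared-concept-name A (inj₂ refl)               inB = ⊥-elim (A₀∉𝒞B inB)

r₀∉𝒞B : ¬ RNinSig 0 𝒞B (cname 3)
r₀∉𝒞B (inj₁ (here (inj₁ ())))
r₀∉𝒞B (inj₁ (here (inj₂ (inj₁ ()))))
r₀∉𝒞B (inj₁ (here (inj₂ (inj₂ ()))))
r₀∉𝒞B (inj₁ (there (here (inj₁ (inj₁ ())))))
r₀∉𝒞B (inj₁ (there (here (inj₁ (inj₂ ())))))
r₀∉𝒞B (inj₁ (there (here (inj₂ ()))))
r₀∉𝒞B (inj₂ (inj₂ ()))

data Point : Set where
  x y z : Point

data Label : ConceptName → Point → Set where
  A₀x : Label 0 x
  A₃x : Label 3 x
  A₁y : Label 1 y
  A₂z : Label 2 z

data Edge : RoleName → Point → Point → Set where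
  r₀xy : Edge 0 x y
  r₁yz : Edge 1 y z
  r₂xz : Edge 2 x z

countermodel : Interp
countermodel = record { Δ = Point ; conc = Label ; role = Edge }

countermodel-⊨-𝒞A∪𝒞B : Model countermodel (𝒞A ∪ 𝒞B)
countermodel-⊨-𝒞A∪𝒞B = (A₀⊑∃r₀A₁ ∷ A₁⊑∃r₁A₂ ∷ ∃r₂A₂⊑A₃ ∷ []) , (r₀∘r₁⊑r₂ ∷ [])
  where
  A₀⊑∃r₀A₁ : ∀ p → Label 0 p → Σ Point λ q → Edge 0 p q × Label 1 q
  A₀⊑∃r₀A₁ .x A₀x = y , r₀xy , A₁y
  A₁⊑∃r₁A₂ : ∀ p → Label 1 p → Σ Point λ q → Edge 1 p q × Label 2 q
  A₁⊑∃r₁A₂ .y A₁y = z , r₁yz , A₂z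
  ∃r₂A₂⊑A₃ : ∀ p → (Σ Point λ q → Edge 2 p q × Label 2 q) → Label 3 p
  ∃r₂A₂⊑A₃ .x (.z , r₂xz , A₂z) = A₃x
  r₀∘r₁⊑r₂ : ∀ p q s → Edge 0 p q → Edge 1 q s → Edge 2 p s
  r₀∘r₁⊑r₂ .x .y .z r₀xy r₁yz = r₂xz

no-A₁-concept-at-z : ∀ T → ConceptNamesWithin (_≡ 1) T → ¬ ⟦ T ⟧ countermodel z
no-A₁-concept-at-z (cname .2) only-A₁ A₂z with only-A₁ 2 refl
... | ()
no-A₁-concept-at-z (T ⊓ _) only-A₁ (Tz , _) = no-A₁-concept-at-z T (λ A → only-A₁ A ∘ inj₁) Tz
no-A₁-concept-at-z (ex r T) only-A₁ (_ , () , _)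

no-shared-concept-at-x : ∀ T → ConceptNamesWithin (_≡ 1) T → RoleNamesWithin (_≢ 0) T →
                         ¬ ⟦ T ⟧ countermodel x
no-shared-concept-at-x (cname .0) only-A₁ _ A₀x with only-A₁ 0 refl
... | ()
no-shared-concept-at-x (cname .3) only-A₁ _ A₃x with only-A₁ 3 refl
... | ()
no-shared-concept-at-x (T ⊓ _) only-A₁ not-r₀ (Tx , _) =
  no-shared-concept-at-x T (λ A → only-A₁ A ∘ inj₁) (λ r → not-r₀ r ∘ inj₁) Tx
no-shared-concept-at-x (ex .0 T) _ not-r₀ (.y , r₀xy , _) = not-r₀ 0 (inj₁ refl) refl
no-shared-concept-at-x (ex .2 T) only-A₁ _ (.z , r₂xz , Tz) = no-A₁-concept-at-z T only-A₁ Tz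

corollary15 : Σ CBox λ 𝒞A → Σ CBox λ 𝒞B → Σ Concept λ C → Σ Concept λ D →
    ((𝒞A ∪ 𝒞B) ⊨ C ⊑ D) ×
    ¬ (Σ Concept λ T → SharedOnly T 𝒞A C 𝒞B D × ((𝒞A ∪ 𝒞B) ⊨ C ⊑ T) × ((𝒞A ∪ 𝒞B) ⊨ T ⊑ D))
corollary15 =
  𝒞A , 𝒞B , cname 0 , cname 3 , 𝒞A∪𝒞B⊨A₀⊑A₃ ,
  no-interpolant-if-refuted-in-model countermodel countermodel-⊨-𝒞A∪𝒞B x A₀x no-shared-concept
  where
  no-shared-concept : ∀ T → SharedOnly T 𝒞A (cname 0) 𝒞B (cname 3) → ¬ ⟦ T ⟧ countermodel x
  no-shared-concept T (shared-concepts , shared-roles) =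
    no-shared-concept-at-x T
      (λ A A∈T → let (inA , inB) = shared-concepts A A∈T in shared-concept-name A inA inB)
      (λ r r∈T → let (_ , inB) = shared-roles r r∈T in λ { refl → r₀∉𝒞B inB })
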